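{- If $G$ is a triangle-free tripartite graph (with a given partition of $V(G)$ into three independent sets), then $T(G,3)\le |V(G)|$.
   Context: $T(G,3)$ denotes the number of transversal $3$-MIS's of $G$: maximal independent sets (independent sets maximal under inclusion) of size $3$ that contain exactly one vertex from each of the three parts. -}

module Defs where

open import Data.Nat using (ℕ)
open import Data.Fin using (Fin)
open import Data.Product using (_×_; ∃)
open import Data.Sum using (_⊎_)
open import Data.Empty using (⊥)
open import Relation.Nullary using (¬_)
open import Relation.Binary.PropositionalEquality using (_≡_; _≢_)

record Graph (n : ℕ) : Set₁ where
  field
    E     : Fin n → Fin n → Set
    sym   : ∀ {u v} → E u v → E v u
    irrefl : ∀ {v} → ¬ E v v

open Graph public

IsTripartition : ∀ {n} → Graph n → (Fin n → Fin 3) → Set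
IsTripartition G part = ∀ {u v} → E G u v → part u ≢ part v

TriangleFree : ∀ {n} → Graph n → Set
TriangleFree G = ∀ a b c → ¬ (E G a b × E G b c × E G a c)

_∈₃_ : ∀ {n} → Fin n → Fin n × Fin n × Fin n → Set
v ∈₃ (a Data.Product., b Data.Product., c) = v ≡ a ⊎ v ≡ b ⊎ v ≡ c

Independent₃ : ∀ {n} → Graph n → Fin n × Fin n × Fin n → Set
Independent₃ G t = ∀ x y → x ∈₃ t → y ∈₃ t → ¬ E G x y

MaximalIndependent₃ : ∀ {n} → Graph n → Fin n × Fin n × Fin n → Set
MaximalIndependent₃ G t =
  Independent₃ G t × (∀ v → ¬ (v ∈₃ t) → ∃ λ u → u ∈₃ t × E G v u)

-- A transversal 3-MIS, represented canonically as the triple (a,b,c) with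
-- a in part 0, b in part 1, c in part 2 (so a,b,c are distinct, the set has
-- size 3, and contains exactly one vertex of each part).  This triple
-- representation is in bijection with the transversal 3-MIS's as sets.
Transversal3MIS : ∀ {n} → Graph n → (Fin n → Fin 3) → Fin n × Fin n × Fin n → Set
Transversal3MIS G part (a Data.Product., b Data.Product., c) =
  part a ≡ Fin.zero × part b ≡ Fin.suc Fin.zero × part c ≡ Fin.suc (Fin.suc Fin.zero)
  × MaximalIndependent₃ G (a Data.Product., b Data.Product., c)
  where import Data.Fin as Fin

{-# OPTIONS --safe #-}
-- Two transversal 3-MIS's agreeing in two parts agree in the third: a different third vertex would be
-- dominated by, hence adjacent to, one of the two shared ones. So when distinct transversal 3-MIS's share a
-- vertex, each of their remaining vertices is adjacent to the other's remaining vertex in the opposite part.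
-- If each vertex of t = (a, b, c) were shared with another transversal 3-MIS, triangle-freeness would force
-- a chain of such adjacencies closing into a triangle. Hence every transversal 3-MIS has a vertex shared with
-- no other one, and sending it to that vertex is an injection into V(G).
module Submission where

open import Defs hiding (sym)
open import Data.Nat using (ℕ; _≤_)
open import Data.Fin using (Fin; zero; suc; _≟_)
open import Data.Fin.Patterns using (0F; 1F; 2F)
open import Data.Fin.Properties using (any?; injective⇒≤)
open import Data.Product using (_×_; _,_; proj₁; proj₂; ∃-syntax)
open import Data.Sum using (inj₁; inj₂)
open import Data.Empty using (⊥)
open import Data.List using (List; _∷_; length; lookup)
open import Data.List.Relation.Unary.All as All using (All)
open import Data.List.Relation.Unary.AllPairs using (_∷_)
open import Data.List.Relation.Unary.Unique.Propositional using (Unique)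
open import Data.List.Membership.Propositional.Properties using (∈-lookup)
open import Function using (_∘_)
open import Function.Definitions using (Injective)
open import Relation.Nullary using (¬_; Dec; yes; no; contradiction)
open import Relation.Nullary.Decidable using (_×-dec_; ¬?)
open import Relation.Binary.PropositionalEquality using (_≡_; _≢_; refl; sym; trans; cong; ≢-sym; module ≡-Reasoning)

lookup-injective : ∀ {A : Set} {xs : List A} → Unique xs → Injective _≡_ _≡_ (lookup xs)
lookup-injective (_ ∷ _) {zero} {zero} _ = refl
lookup-injective (x∉xs ∷ _) {zero} {suc j} x≡xⱼ = contradiction x≡xⱼ (All.lookup x∉xs (∈-lookup j))
lookup-injective (x∉xs ∷ _) {suc i} {zero} xᵢ≡x = contradiction (sym xᵢ≡x) (All.lookup x∉xs (∈-lookup i))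
lookup-injective (_ ∷ unique) {suc i} {suc j} xᵢ≡xⱼ = cong suc (lookup-injective unique xᵢ≡xⱼ)

Triple : ℕ → Set
Triple n = Fin n × Fin n × Fin n

coord : ∀ {n} → Fin 3 → Triple n → Fin n
coord 0F (a , _ , _) = a
coord 1F (_ , b , _) = b
coord 2F (_ , _ , c) = c

module _ {n : ℕ} (G : Graph n) (part : Fin n → Fin 3) (tripartite : IsTripartition G part) where

  private variable
    u v w x y z y′ z′ : Fin n

  ∈₃-rotate : v ∈₃ (x , y , z) → v ∈₃ (y , z , x)
  ∈₃-rotate (inj₁ v≡x)        = inj₂ (inj₂ v≡x)
  ∈₃-rotate (inj₂ (inj₁ v≡y)) = inj₁ v≡y
  ∈₃-rotate (inj₂ (inj₂ v≡z)) = inj₂ (inj₁ v≡z)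

  ∈₃-swap : v ∈₃ (x , y , z) → v ∈₃ (y , x , z)
  ∈₃-swap (inj₁ v≡x)        = inj₂ (inj₁ v≡x)
  ∈₃-swap (inj₂ (inj₁ v≡y)) = inj₁ v≡y
  ∈₃-swap (inj₂ (inj₂ v≡z)) = inj₂ (inj₂ v≡z)

  MaximalIndependent₃-resp-∈₃ : ∀ {s t} → (∀ {v} → v ∈₃ s → v ∈₃ t) → (∀ {v} → v ∈₃ t → v ∈₃ s)
                              → MaximalIndependent₃ G s → MaximalIndependent₃ G t
  MaximalIndependent₃-resp-∈₃ s⊆t t⊆s (no-edges , maximal) =
    (λ x y x∈t y∈t → no-edges x y (t⊆s x∈t) (t⊆s y∈t)) ,
    (λ v v∉t → let (u , u∈s , vu) = maximal v (v∉t ∘ s⊆t) in u , s⊆t u∈s , vu)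

  -- Unlike Transversal3MIS, the parts are not tied to positions, so the notion is closed under permutation.
  record TransversalMIS (x y z : Fin n) : Set where
    constructor transversal-mis
    field
      parts-distinct      : part x ≢ part y × part y ≢ part z × part z ≢ part x
      maximal-independent : MaximalIndependent₃ G (x , y , z)

  rotate : TransversalMIS x y z → TransversalMIS y z x
  rotate (transversal-mis (xy , yz , zx) mis) =
    transversal-mis (yz , zx , xy) (MaximalIndependent₃-resp-∈₃ ∈₃-rotate (∈₃-rotate ∘ ∈₃-rotate) mis)

  swap : TransversalMIS x y z → TransversalMIS y x z
  swap (transversal-mis (xy , yz , zx) mis) =
    transversal-mis (≢-sym xy , ≢-sym zx , ≢-sym yz) (MaximalIndependent₃-resp-∈₃ ∈₃-swap ∈₃-swap mis)

  Transversal3MIS⇒TransversalMIS : Transversal3MIS G part (x , y , z) → TransversalMIS x y z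
  Transversal3MIS⇒TransversalMIS (px , py , pz , mis) =
    transversal-mis (parts-differ px py (λ ()) , parts-differ py pz (λ ()) , parts-differ pz px (λ ())) mis
    where
    parts-differ : ∀ {u w k l} → part u ≡ k → part w ≡ l → k ≢ l → part u ≢ part w
    parts-differ pu pw k≢l pu≡pw = k≢l (trans (sym pu) (trans pu≡pw pw))

  independent : TransversalMIS x y z → ¬ E G x y
  independent (transversal-mis _ (no-edges , _)) = no-edges _ _ (inj₁ refl) (inj₂ (inj₁ refl))

  dominated : TransversalMIS x y z → part v ≡ part x → v ≢ x → ¬ E G v y → E G v z
  dominated {x} {y} {z} {v} (transversal-mis (xy , _ , zx) (_ , maximal)) pv≡px v≢x v≁y
    with maximal v v∉t
    where
    v∉t : ¬ v ∈₃ (x , y , z)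
    v∉t (inj₁ v≡x)          = v≢x v≡x
    v∉t (inj₂ (inj₁ refl)) = xy (sym pv≡px)
    v∉t (inj₂ (inj₂ refl)) = zx pv≡px
  ... | _ , inj₁ refl , vx        = contradiction pv≡px (tripartite vx)
  ... | _ , inj₂ (inj₁ refl) , vy = contradiction vy v≁y
  ... | _ , inj₂ (inj₂ refl) , vz = vz

  determined : TransversalMIS x y z → TransversalMIS x y z′ → part z′ ≡ part z → z′ ≡ z
  determined {z = z} {z′} t t′ pz′≡pz with z′ ≟ z
  ... | yes z′≡z = z′≡z
  ... | no z′≢z  = contradiction
    (dominated (rotate (rotate t)) pz′≡pz z′≢z (independent (rotate (rotate t′))))
    (independent (swap (rotate t′)))

  cross-adjacent : TransversalMIS x y z → TransversalMIS x y′ z′ → part y′ ≡ part y → part z′ ≡ part z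
                 → (y′ , z′) ≢ (y , z) → E G y′ z
  cross-adjacent {y = y} {y′ = y′} t t′ py′≡py pz′≡pz distinct =
    dominated (swap t) py′≡py y′≢y (independent (swap t′))
    where
    y′≢y : y′ ≢ y
    y′≢y refl with refl ← determined t t′ pz′≡pz = distinct refl

  part-coord : ∀ {t} → Transversal3MIS G part t → ∀ k → part (coord k t) ≡ k
  part-coord (p , _) 0F         = p
  part-coord (_ , p , _) 1F     = p
  part-coord (_ , _ , p , _) 2F = p

  same-part : ∀ {s t} → Transversal3MIS G part s → Transversal3MIS G part t
            → ∀ k → part (coord k s) ≡ part (coord k t)
  same-part ms mt k = trans (part-coord ms k) (sym (part-coord mt k))

  module _ (triangle-free : TriangleFree G) where

    common-neighbour⇒non-adjacent : E G u w → E G v w → ¬ E G u v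
    common-neighbour⇒non-adjacent uw vw uv = triangle-free _ _ _ (uv , vw , uw)

    ¬all-vertices-shared : ∀ {t t₁ t₂ t₃} → Transversal3MIS G part t
      → Transversal3MIS G part t₁ → t₁ ≢ t → coord 0F t₁ ≡ coord 0F t
      → Transversal3MIS G part t₂ → t₂ ≢ t → coord 1F t₂ ≡ coord 1F t
      → Transversal3MIS G part t₃ → t₃ ≢ t → coord 2F t₃ ≡ coord 2F t
      → ⊥
    ¬all-vertices-shared {a , b , c} {.a , b₁ , c₁} {a₂ , .b , c₂} {a₃ , b₃ , .c}
                         M M₁ t₁≢t refl M₂ t₂≢t refl M₃ t₃≢t refl =
      triangle-free a b₃ c₂ (Graph.sym G b₃~a , b₃~c₂ , Graph.sym G c₂~a)
      where
      m = Transversal3MIS⇒TransversalMIS M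
      m₁ = Transversal3MIS⇒TransversalMIS M₁
      m₂ = Transversal3MIS⇒TransversalMIS M₂
      m₃ = Transversal3MIS⇒TransversalMIS M₃
      pa₂ = same-part M₂ M 0F
      pa₃ = same-part M₃ M 0F
      pb₁ = same-part M₁ M 1F
      pb₃ = same-part M₃ M 1F
      pc₁ = same-part M₁ M 2F
      pc₂ = same-part M₂ M 2F

      b₁~c : E G b₁ c
      b₁~c = cross-adjacent m m₁ pb₁ pc₁ λ { refl → t₁≢t refl }
      c₁~b : E G c₁ b
      c₁~b = cross-adjacent (rotate (swap m)) (rotate (swap m₁)) pc₁ pb₁ λ { refl → t₁≢t refl }
      a₂~c : E G a₂ c
      a₂~c = cross-adjacent (swap m) (swap m₂) pa₂ pc₂ λ { refl → t₂≢t refl }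
      c₂~a : E G c₂ a
      c₂~a = cross-adjacent (rotate m) (rotate m₂) pc₂ pa₂ λ { refl → t₂≢t refl }
      a₃~b : E G a₃ b
      a₃~b = cross-adjacent (rotate (rotate m)) (rotate (rotate m₃)) pa₃ pb₃ λ { refl → t₃≢t refl }
      b₃~a : E G b₃ a
      b₃~a = cross-adjacent (swap (rotate m)) (swap (rotate m₃)) pb₃ pa₃ λ { refl → t₃≢t refl }

      -- In each step the other vertex offered by domination has a common neighbour with the dominated one.
      a₂~c₁ : E G a₂ c₁
      a₂~c₁ = dominated m₁ pa₂ (λ { refl → independent (rotate (swap m)) a₂~c })
                (common-neighbour⇒non-adjacent a₂~c b₁~c)
      c₁~b₃ : E G c₁ b₃
      c₁~b₃ = dominated (rotate (rotate m₃)) pc₁ (λ { refl → independent (swap (rotate m)) c₁~b })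
                (common-neighbour⇒non-adjacent c₁~b a₃~b)
      b₃~c₂ : E G b₃ c₂
      b₃~c₂ = dominated (swap m₂) pb₃ (λ { refl → independent (swap m) b₃~a })
                (common-neighbour⇒non-adjacent (Graph.sym G c₁~b₃) a₂~c₁)

    module _ (ts : List (Triple n)) (unique : Unique ts) (all-mis : All (Transversal3MIS G part) ts) where

      private
        t : Fin (length ts) → Triple n
        t = lookup ts

        mis : ∀ i → Transversal3MIS G part (t i)
        mis i = All.lookup all-mis (∈-lookup i)

      Shared : Fin 3 → Fin (length ts) → Set
      Shared k i = ∃[ j ] j ≢ i × coord k (t j) ≡ coord k (t i)

      shared? : ∀ k i → Dec (Shared k i)
      shared? k i = any? λ j → ¬? (j ≟ i) ×-dec (coord k (t j) ≟ coord k (t i))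

      private-coord : ∀ i → ∃[ k ] ¬ Shared k i
      private-coord i with shared? 0F i | shared? 1F i | shared? 2F i
      ... | no ¬shared | _ | _          = 0F , ¬shared
      ... | yes _ | no ¬shared | _      = 1F , ¬shared
      ... | yes _ | yes _ | no ¬shared = 2F , ¬shared
      ... | yes (j₀ , j₀≢i , e₀) | yes (j₁ , j₁≢i , e₁) | yes (j₂ , j₂≢i , e₂) =
        contradiction e₂ (¬all-vertices-shared (mis i) (mis j₀) (distinct j₀≢i) e₀
                                                (mis j₁) (distinct j₁≢i) e₁ (mis j₂) (distinct j₂≢i))
        where
        distinct : ∀ {j} → j ≢ i → t j ≢ t i
        distinct j≢i = j≢i ∘ lookup-injective unique

      private-vertex : Fin (length ts) → Fin n
      private-vertex i = coord (proj₁ (private-coord i)) (t i)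

      private-vertex-injective : Injective _≡_ _≡_ private-vertex
      private-vertex-injective {i} {j} vᵢ≡vⱼ with i ≟ j
      ... | yes i≡j = i≡j
      ... | no i≢j  = contradiction (j , ≢-sym i≢j , shared-coord) (proj₂ (private-coord i))
        where
        open ≡-Reasoning
        kᵢ = proj₁ (private-coord i)
        kⱼ = proj₁ (private-coord j)
        kⱼ≡kᵢ : kⱼ ≡ kᵢ
        kⱼ≡kᵢ = begin
          kⱼ                     ≡⟨ sym (part-coord (mis j) kⱼ) ⟩
          part (private-vertex j) ≡⟨ cong part (sym vᵢ≡vⱼ) ⟩
          part (private-vertex i) ≡⟨ part-coord (mis i) kᵢ ⟩
          kᵢ                     ∎
        shared-coord : coord kᵢ (t j) ≡ coord kᵢ (t i)
        shared-coord = trans (cong (λ k → coord k (t j)) (sym kⱼ≡kᵢ)) (sym vᵢ≡vⱼ)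

lemma4p2 : ∀ (n : ℕ) (G : Graph n) (part : Fin n → Fin 3)
             → IsTripartition G part → TriangleFree G
             → (ts : List (Fin n × Fin n × Fin n))
             → Unique ts → All (Transversal3MIS G part) ts
             → length ts ≤ n
lemma4p2 n G part tripartite triangle-free ts unique all-mis =
  injective⇒≤ (private-vertex-injective G part tripartite triangle-free ts unique all-mis)
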